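{- There is a function $C_5(t)$ such that the following holds for all $t\in\mathbb{N}$: every connected bipartite graph $G$ with minimum degree $\delta(G)\geq C_5(t)$ which is induced $S_{t,t}$-free has diameter at most $5$.
   Context: $S_{t,t}$ is the graph with vertex set $\{x,x_1,\dots,x_t,y,y_1,\dots,y_t\}$ and edge set $\{xy\}\cup\{xy_1,\dots,xy_t\}\cup\{yx_1,\dots,yx_t\}$; induced $S_{t,t}$-free means no induced subgraph isomorphic to $S_{t,t}$. -}

module Defs where

open import Data.Nat using (ℕ; zero; suc; _≤_)
open import Data.Fin using (Fin)
open import Data.Bool using (Bool; true; false; T; not; _≟_)
open import Data.List using (List; filter; length)
open import Data.List.Base using (allFin)
open import Data.Sum using (_⊎_)
open import Data.Product using (Σ; _×_; ∃)
open import Relation.Binary.PropositionalEquality using (_≡_; _≢_)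
open import Function.Definitions using (Injective)
open import Relation.Nullary using (¬_)

record Graph (n : ℕ) : Set where
  field
    adj   : Fin n → Fin n → Bool
    sym   : ∀ u v → adj u v ≡ adj v u
    irrefl : ∀ v → adj v v ≡ false

open Graph public

Adj : ∀ {n} → Graph n → Fin n → Fin n → Set
Adj G u v = T (adj G u v)

degree : ∀ {n} → Graph n → Fin n → ℕ
degree {n} G v = length (filter (λ u → adj G v u ≟ true) (allFin n))

MinDegree≥ : ∀ {n} → Graph n → ℕ → Set
MinDegree≥ {n} G d = (v : Fin n) → d ≤ degree G v

data Walk {n} (G : Graph n) : Fin n → Fin n → ℕ → Set where
  here : ∀ {u} → Walk G u u zero
  step : ∀ {u w v k} → Adj G u w → Walk G w v k → Walk G u v (suc k)

Dist≤ : ∀ {n} → Graph n → Fin n → Fin n → ℕ → Set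
Dist≤ G u v k = Σ ℕ λ l → l ≤ k × Walk G u v l

Connected : ∀ {n} → Graph n → Set
Connected {n} G = (u v : Fin n) → Σ ℕ λ l → Walk G u v l

Diameter≤ : ∀ {n} → Graph n → ℕ → Set
Diameter≤ {n} G k = (u v : Fin n) → Dist≤ G u v k

Bipartite : ∀ {n} → Graph n → Set
Bipartite {n} G = Σ (Fin n → Bool) λ c → ∀ u v → Adj G u v → c u ≢ c v

data SVert (t : ℕ) : Set where
  x y : SVert t
  xi yi : Fin t → SVert t

SAdj : ∀ {t} → SVert t → SVert t → Bool
SAdj x y = true
SAdj y x = true
SAdj x (yi _) = true
SAdj (yi _) x = true
SAdj y (xi _) = true
SAdj (xi _) y = true
SAdj _ _ = false

HasInducedS : ∀ {n} → Graph n → ℕ → Set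
HasInducedS {n} G t =
  Σ (SVert t → Fin n) λ f → Injective _≡_ _≡_ f × (∀ a b → adj G (f a) (f b) ≡ SAdj a b)

InducedSFree : ∀ {n} → Graph n → ℕ → Set
InducedSFree G t = ¬ HasInducedS G t

-- Besides S_{t,t}-freeness only triangle-freeness is used. If X ~ Y and t neighbours of X
-- each have fewer than s neighbours in a set Q ⊆ N(Y) with |Q| ≥ ts, a union bound leaves t
-- vertices of Q adjacent to none of them, and together with X and Y these span an induced
-- S_{t,t}; so fewer than t neighbours of X are that sparse towards Q. Call b far from u if b and
-- u have no common neighbour. Three applications of this principle along a path u w q z show
-- that z has fewer than t² neighbours far from u. On a walk of length 6 from u to v the middle
-- vertex has at least 2t² neighbours, so one of them is far from neither u nor v, which yields
-- a walk of length 4. Shortening walks in this way bounds the diameter by 5, with C₅(t) = 2t².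
module Submission where

open import Data.Bool using (true; false; not; _≟_)
open import Data.Bool.Properties using (T-≡; ¬-not; not-involutive)
open import Data.Empty using (⊥)
open import Data.Fin using (Fin; zero; suc)
open import Data.Fin.Properties using (any?)
open import Data.List using (List; []; _∷_; length; filter; allFin)
open import Data.List.Membership.Propositional using (_∈_; lose)
open import Data.List.Membership.Propositional.Properties using (∈-allFin; ∈-filter⁻)
open import Data.List.Properties using (filter-some; filter-none)
import Data.List.Relation.Unary.All as All
open import Data.List.Relation.Unary.AllPairs using (_∷_)
open import Data.List.Relation.Unary.Any using (here; there)
open import Data.List.Relation.Unary.Unique.Propositional using (Unique)
open import Data.List.Relation.Unary.Unique.Propositional.Properties using (allFin⁺; filter⁺)
open import Data.Nat using (ℕ; zero; suc; _+_; _*_; _≤_; _<_; _<?_; z≤n; s≤s)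
open import Data.Nat.Properties hiding (_≟_)
open import Data.Product using (Σ; ∃; _×_; _,_; proj₁; proj₂)
open import Data.Sum using (inj₁; inj₂)
open import Function using (_∘_)
open import Function.Bundles using (Equivalence)
open import Function.Definitions using (Injective)
open import Level using (0ℓ)
open import Relation.Binary.PropositionalEquality using (_≡_; refl; sym; trans; cong)
open import Relation.Nullary using (¬_; yes; no; contradiction)
open import Relation.Unary using (Pred; Decidable; _⊆_; _∩_; _∪_; ∁; ⋃)
open import Relation.Unary.Properties using (_∩?_; _∪?_; ∁?)

open import Defs hiding (sym)

m≤m*m : ∀ m → m ≤ m * m
m≤m*m zero    = z≤n
m≤m*m (suc m) = m≤m*n (suc m) (suc m)

module _ {A : Set} where

  count : {P : Pred A 0ℓ} → Decidable P → List A → ℕ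
  count P? xs = length (filter P? xs)

  module _ {P Q : Pred A 0ℓ} (P? : Decidable P) (Q? : Decidable Q) where

    count-mono : P ⊆ Q → ∀ xs → count P? xs ≤ count Q? xs
    count-mono P⊆Q [] = z≤n
    count-mono P⊆Q (a ∷ xs) with P? a | Q? a
    ... | yes _ | yes _  = s≤s (count-mono P⊆Q xs)
    ... | yes p | no ¬q  = contradiction (P⊆Q p) ¬q
    ... | no _  | yes _  = m≤n⇒m≤1+n (count-mono P⊆Q xs)
    ... | no _  | no _   = count-mono P⊆Q xs

    count-∩∁ : ∀ xs → count P? xs ≡ count (P? ∩? Q?) xs + count (P? ∩? ∁? Q?) xs
    count-∩∁ [] = refl
    count-∩∁ (a ∷ xs) with P? a | Q? a
    ... | yes _ | yes _ = cong suc (count-∩∁ xs)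
    ... | yes _ | no _  = trans (cong suc (count-∩∁ xs)) (sym (+-suc _ _))
    ... | no _  | _     = count-∩∁ xs

    count-∪ : ∀ xs → count (P? ∪? Q?) xs ≤ count P? xs + count Q? xs
    count-∪ [] = z≤n
    count-∪ (a ∷ xs) with P? a | Q? a
    ... | yes _ | yes _ = s≤s (≤-trans (count-∪ xs) (+-monoʳ-≤ (count P? xs) (n≤1+n _)))
    ... | yes _ | no _  = s≤s (count-∪ xs)
    ... | no _  | yes _ = ≤-trans (s≤s (count-∪ xs)) (≤-reflexive (sym (+-suc _ _)))
    ... | no _  | no _  = count-∪ xs

    ∁-count-lower : ∀ xs {k} → count (P? ∩? Q?) xs + k ≤ count P? xs → k ≤ count (P? ∩? ∁? Q?) xs
    ∁-count-lower xs {k} le = +-cancelˡ-≤ _ k _ (≤-trans le (≤-reflexive (count-∩∁ xs)))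

    ∩-count-lower : ∀ xs {k} → k + count (P? ∩? ∁? Q?) xs ≤ count P? xs → k ≤ count (P? ∩? Q?) xs
    ∩-count-lower xs {k} le = +-cancelʳ-≤ _ k _ (≤-trans le (≤-reflexive (count-∩∁ xs)))

  module _ {P : Pred A 0ℓ} (P? : Decidable P) where

    count-none : (∀ a → ¬ P a) → ∀ xs → count P? xs ≡ 0
    count-none none xs = cong length (filter-none P? (All.universal none xs))

    count>0⇒∃ : ∀ xs → 0 < count P? xs → ∃ P
    count>0⇒∃ (a ∷ xs) pos with P? a
    ... | yes p = a , p
    ... | no _  = count>0⇒∃ xs pos

    ∈⇒count>0 : ∀ {a xs} → a ∈ xs → P a → 0 < count P? xs
    ∈⇒count>0 a∈xs p = filter-some P? (lose a∈xs p)

  ∃-∩∁ : ∀ {P Q : Pred A 0ℓ} (P? : Decidable P) (Q? : Decidable Q) xs →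
         count (P? ∩? Q?) xs < count P? xs → ∃ λ a → P a × ¬ Q a
  ∃-∩∁ P? Q? xs lt =
    count>0⇒∃ (P? ∩? ∁? Q?) xs (∁-count-lower P? Q? xs (≤-trans (≤-reflexive (+-comm _ 1)) lt))

  count-∩-⋃ : ∀ {P : Pred A 0ℓ} (P? : Decidable P) {k} {R : Fin k → Pred A 0ℓ}
              (R? : ∀ j → Decidable (R j)) s xs → (∀ j → count (P? ∩? R? j) xs < s) →
              count (P? ∩? (λ a → any? (λ j → R? j a))) xs + k ≤ k * s
  count-∩-⋃ P? {zero} R? s xs _ =
    ≤-reflexive (trans (+-identityʳ _) (count-none (P? ∩? _) (λ { _ (_ , () , _) }) xs))
  count-∩-⋃ {P} P? {suc k} {R} R? s xs bound = begin
      count (P? ∩? hit?) xs + suc k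
    ≤⟨ +-monoˡ-≤ (suc k) (≤-trans (count-mono (P? ∩? hit?) ((P? ∩? R? zero) ∪? (P? ∩? hit′?)) split xs)
                                  (count-∪ (P? ∩? R? zero) (P? ∩? hit′?) xs)) ⟩
      count (P? ∩? R? zero) xs + count (P? ∩? hit′?) xs + suc k
    ≡⟨ trans (+-suc _ k) (cong suc (+-assoc (count (P? ∩? R? zero) xs) _ k)) ⟩
      suc (count (P? ∩? R? zero) xs) + (count (P? ∩? hit′?) xs + k)
    ≤⟨ +-mono-≤ (bound zero) (count-∩-⋃ P? (R? ∘ suc) s xs (bound ∘ suc)) ⟩
      s + k * s
    ∎
    where
      open ≤-Reasoning
      hit? : Decidable (⋃ (Fin (suc k)) R)
      hit? a = any? (λ j → R? j a)
      hit′? : Decidable (⋃ (Fin k) (R ∘ suc))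
      hit′? a = any? (λ j → R? (suc j) a)
      split : P ∩ ⋃ (Fin (suc k)) R ⊆ (P ∩ R zero) ∪ (P ∩ ⋃ (Fin k) (R ∘ suc))
      split (p , zero  , r) = inj₁ (p , r)
      split (p , suc j , r) = inj₂ (p , j , r)

  distinct-elements : ∀ t {xs : List A} → Unique xs → t ≤ length xs →
                      Σ (Fin t → A) λ g → Injective _≡_ _≡_ g × (∀ i → g i ∈ xs)
  distinct-elements zero    _              _       = (λ ()) , (λ { {()} }) , (λ ())
  distinct-elements (suc t) {a ∷ xs} (a∉xs ∷ u) (s≤s t≤) with distinct-elements t u t≤
  ... | g , g-inj , g∈ = g′ , g′-inj , g′∈
    where
      g′ : Fin (suc t) → A
      g′ zero    = a
      g′ (suc i) = g i
      g′-inj : Injective _≡_ _≡_ g′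
      g′-inj {zero}  {zero}  _ = refl
      g′-inj {zero}  {suc j} e = contradiction e (All.lookup a∉xs (g∈ j))
      g′-inj {suc i} {zero}  e = contradiction (sym e) (All.lookup a∉xs (g∈ i))
      g′-inj {suc i} {suc j} e = cong suc (g-inj e)
      g′∈ : ∀ i → g′ i ∈ a ∷ xs
      g′∈ zero    = here refl
      g′∈ (suc i) = there (g∈ i)

  choose : ∀ t {P : Pred A 0ℓ} (P? : Decidable P) {xs} → Unique xs → t ≤ count P? xs →
           Σ (Fin t → A) λ g → Injective _≡_ _≡_ g × (∀ i → P (g i))
  choose t P? {xs} u t≤ with distinct-elements t (filter⁺ P? u) t≤
  ... | g , g-inj , g∈ = g , g-inj , λ i → proj₂ (∈-filter⁻ P? {xs = xs} (g∈ i))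

module _ {n : ℕ} where

  ∣_∣ : {P : Pred (Fin n) 0ℓ} → Decidable P → ℕ
  ∣ P? ∣ = count P? (allFin n)

  choose-vertices : ∀ t {P : Pred (Fin n) 0ℓ} (P? : Decidable P) → t ≤ ∣ P? ∣ →
                    Σ (Fin t → Fin n) λ g → Injective _≡_ _≡_ g × (∀ i → P (g i))
  choose-vertices t P? = choose t P? (allFin⁺ n)

TriangleFree : ∀ {n} → Graph n → Set
TriangleFree G = ∀ p q r → Adj G p q → Adj G q r → Adj G r p → ⊥

bipartite⇒triangleFree : ∀ {n} {G : Graph n} → Bipartite G → TriangleFree G
bipartite⇒triangleFree (c , proper) p q r pq qr rp =
  proper r p rp (sym (trans (¬-not (proper p q pq))
                     (trans (cong not (¬-not (proper q r qr))) (not-involutive (c r)))))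

module Neighbourhood {n} (G : Graph n) where

  N : Fin n → Pred (Fin n) 0ℓ
  N v w = adj G v w ≡ true

  N? : ∀ v → Decidable (N v)
  N? v w = adj G v w ≟ true

  N-sym : ∀ {v w} → N v w → N w v
  N-sym {v} {w} = trans (Graph.sym G w v)

  N⇒Adj : ∀ {v w} → N v w → Adj G v w
  N⇒Adj = Equivalence.from T-≡

  Adj⇒N : ∀ {v w} → Adj G v w → N v w
  Adj⇒N = Equivalence.to T-≡

  codegree : Fin n → Fin n → ℕ
  codegree v w = ∣ N? v ∩? N? w ∣

module _ {n} {G : Graph n} (△-free : TriangleFree G) where

  open Neighbourhood G

  common-neighbour⇒nonadjacent : ∀ {p q r} → N r p → N r q → adj G p q ≡ false
  common-neighbour⇒nonadjacent {p} {q} {r} rp rq =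
    ¬-not λ pq → △-free p q r (N⇒Adj pq) (N⇒Adj (N-sym rq)) (N⇒Adj rp)

  -- X, Y play x, y; the A j play the y_j and the B k the x_k.
  S-from-edge : ∀ {t X Y} → N X Y → (A B : Fin t → Fin n) →
                Injective _≡_ _≡_ A → Injective _≡_ _≡_ B →
                (∀ j → N X (A j)) → (∀ k → N Y (B k)) → (∀ j k → ¬ N (A j) (B k)) →
                HasInducedS G t
  S-from-edge {t} {X} {Y} XY A B A-inj B-inj XA YB A≁B = f , f-inj , f-adj
    where
      f : SVert t → Fin n
      f x      = X
      f y      = Y
      f (xi k) = B k
      f (yi j) = A j

      apart : ∀ {p q r} → N r p → N r q → adj G p q ≡ false
      apart = common-neighbour⇒nonadjacent

      f-adj : ∀ a b → adj G (f a) (f b) ≡ SAdj a b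
      f-adj x      x      = irrefl G X
      f-adj x      y      = XY
      f-adj x      (xi k) = apart (N-sym XY) (YB k)
      f-adj x      (yi j) = XA j
      f-adj y      x      = N-sym XY
      f-adj y      y      = irrefl G Y
      f-adj y      (xi k) = YB k
      f-adj y      (yi j) = apart XY (XA j)
      f-adj (xi k) x      = apart (YB k) (N-sym XY)
      f-adj (xi k) y      = N-sym (YB k)
      f-adj (xi k) (xi l) = apart (YB k) (YB l)
      f-adj (xi k) (yi j) = ¬-not (A≁B j k ∘ N-sym)
      f-adj (yi j) x      = N-sym (XA j)
      f-adj (yi j) y      = apart (XA j) XY
      f-adj (yi j) (xi k) = ¬-not (A≁B j k)
      f-adj (yi j) (yi l) = apart (XA j) (XA l)

      row : ∀ a b → f a ≡ f b → ∀ c → SAdj a c ≡ SAdj b c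
      row a b e c = trans (sym (f-adj a c)) (trans (cong (λ v → adj G v (f c)) e) (f-adj b c))

      f-inj : Injective _≡_ _≡_ f
      f-inj {x}    {x}    _ = refl
      f-inj {y}    {y}    _ = refl
      f-inj {xi k} {xi l} e = cong xi (B-inj e)
      f-inj {yi j} {yi l} e = cong yi (A-inj e)
      f-inj {x}    {y}    e = contradiction (row x y e x) λ ()
      f-inj {y}    {x}    e = contradiction (row y x e x) λ ()
      f-inj {x}    {xi k} e = contradiction (row x (xi k) e (yi k)) λ ()
      f-inj {xi k} {x}    e = contradiction (row (xi k) x e (yi k)) λ ()
      f-inj {x}    {yi j} e = contradiction (row x (yi j) e x) λ ()
      f-inj {yi j} {x}    e = contradiction (row (yi j) x e x) λ ()
      f-inj {y}    {xi k} e = contradiction (row y (xi k) e x) λ ()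
      f-inj {xi k} {y}    e = contradiction (row (xi k) y e x) λ ()
      f-inj {y}    {yi j} e = contradiction (row y (yi j) e (xi j)) λ ()
      f-inj {yi j} {y}    e = contradiction (row (yi j) y e (xi j)) λ ()
      f-inj {xi k} {yi j} e = contradiction (row (xi k) (yi j) e x) λ ()
      f-inj {yi j} {xi k} e = contradiction (row (yi j) (xi k) e x) λ ()

module Diameter {n} {G : Graph n} (△-free : TriangleFree G) {t : ℕ} (S-free : InducedSFree G t) where

  open Neighbourhood G

  Sparse : ℕ → {Q : Pred (Fin n) 0ℓ} → Decidable Q → Pred (Fin n) 0ℓ
  Sparse s Q? a = ∣ Q? ∩? N? a ∣ < s

  sparse? : ∀ s {Q : Pred (Fin n) 0ℓ} (Q? : Decidable Q) → Decidable (Sparse s Q?)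
  sparse? s Q? a = ∣ Q? ∩? N? a ∣ <? s

  sparse-anti : ∀ {s} {Q Q′ : Pred (Fin n) 0ℓ} (Q? : Decidable Q) (Q′? : Decidable Q′) →
                Q ⊆ Q′ → Sparse s Q′? ⊆ Sparse s Q?
  sparse-anti Q? Q′? Q⊆Q′ {a} =
    ≤-<-trans (count-mono (Q? ∩? N? a) (Q′? ∩? N? a) (λ (q , qa) → Q⊆Q′ q , qa) (allFin n))

  common-non-neighbours : ∀ {s} {Q : Pred (Fin n) 0ℓ} (Q? : Decidable Q) (A : Fin t → Fin n) →
                          (∀ j → Sparse s Q? (A j)) → t * s ≤ ∣ Q? ∣ →
                          Σ (Fin t → Fin n) λ B → Injective _≡_ _≡_ B × (∀ k → Q (B k)) ×
                                                  (∀ j k → ¬ N (A j) (B k))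
  common-non-neighbours {s} Q? A A-sparse t*s≤∣Q∣
    with choose-vertices t (Q? ∩? ∁? hit?) (∁-count-lower Q? hit? (allFin n) hit-few)
    where
      hit? : Decidable (⋃ (Fin t) (N ∘ A))
      hit? b = any? (λ j → N? (A j) b)
      hit-few : ∣ Q? ∩? hit? ∣ + t ≤ ∣ Q? ∣
      hit-few = ≤-trans (count-∩-⋃ Q? (N? ∘ A) s (allFin n) A-sparse) t*s≤∣Q∣
  ... | B , B-inj , B∈ = B , B-inj , proj₁ ∘ B∈ , λ j k AB → proj₂ (B∈ k) (j , AB)

  sparse-neighbours-few : ∀ {X Y} s {Q : Pred (Fin n) 0ℓ} (Q? : Decidable Q) →
                          N X Y → Q ⊆ N Y → t * s ≤ ∣ Q? ∣ → ∣ N? X ∩? sparse? s Q? ∣ < t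
  sparse-neighbours-few {X} s Q? XY Q⊆NY t*s≤∣Q∣ = ≰⇒> many⇒S
    where
      many⇒S : ¬ t ≤ ∣ N? X ∩? sparse? s Q? ∣
      many⇒S t≤ with choose-vertices t (N? X ∩? sparse? s Q?) t≤
      ... | A , A-inj , A∈ with common-non-neighbours Q? A (proj₂ ∘ A∈) t*s≤∣Q∣
      ... | B , B-inj , B∈ , A≁B =
        S-free (S-from-edge {G = G} △-free XY A B A-inj B-inj (proj₁ ∘ A∈) (λ k → Q⊆NY (B∈ k)) A≁B)

  Far : Fin n → Pred (Fin n) 0ℓ
  Far u = Sparse 1 (N? u)

  far? : ∀ u → Decidable (Far u)
  far? u = sparse? 1 (N? u)

  N-N⇒¬Far : ∀ {u a b} → N u a → N a b → ¬ Far u b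
  N-N⇒¬Far {u} {a} {b} ua ab far =
    <⇒≱ far (∈⇒count>0 (N? u ∩? N? b) (∈-allFin a) (ua , N-sym ab))

  ¬Far⇒common-neighbour : ∀ {u b} → ¬ Far u b → ∃ λ a → N u a × N a b
  ¬Far⇒common-neighbour {u} {b} ¬far with count>0⇒∃ (N? u ∩? N? b) (allFin n) (≮⇒≥ ¬far)
  ... | a , ua , ba = a , ua , N-sym ba

  N⊆Sparse-Far : ∀ {u} → N u ⊆ Sparse 1 (far? u)
  N⊆Sparse-Far {u} {a} ua =
    s≤s (≤-reflexive (count-none (far? u ∩? N? a) (λ b (far , ab) → N-N⇒¬Far ua ab far) (allFin n)))

  heavy-neighbour⇒sparse-Far : ∀ {u h z} → N h z → t ≤ codegree u h → Sparse t (far? u) z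
  heavy-neighbour⇒sparse-Far {u} {h} {z} hz heavy = ≰⇒> λ t≤∣Q∣ →
    <⇒≱ (sparse-neighbours-few 1 Q? hz proj₂ (≤-trans (≤-reflexive (*-identityʳ t)) t≤∣Q∣))
        (≤-trans heavy (count-mono (N? u ∩? N? h) (N? h ∩? sparse? 1 Q?) N-u∩N-h⊆ (allFin n)))
    where
      Q? : Decidable (Far u ∩ N z)
      Q? = far? u ∩? N? z
      N-u∩N-h⊆ : N u ∩ N h ⊆ N h ∩ Sparse 1 Q?
      N-u∩N-h⊆ (ua , ha) = ha , sparse-anti Q? (far? u) proj₁ (N⊆Sparse-Far ua)

  module _ (δ : MinDegree≥ G (t * t + t * t)) where

    t*t≤deg : ∀ v → t * t ≤ ∣ N? v ∣
    t*t≤deg v = ≤-trans (m≤m+n (t * t) (t * t)) (δ v)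

    heavy-codegree⇒sparse-Far : ∀ {u w z} → N u w → t ≤ codegree w z → Sparse t (far? u) z
    heavy-codegree⇒sparse-Far {u} {w} {z} uw heavy
      with ∃-∩∁ (N? w ∩? N? z) (sparse? t (N? u)) (allFin n) few-light
      where
        few-light : ∣ (N? w ∩? N? z) ∩? sparse? t (N? u) ∣ < codegree w z
        few-light = <-≤-trans
          (≤-<-trans (count-mono ((N? w ∩? N? z) ∩? sparse? t (N? u)) (N? w ∩? sparse? t (N? u))
                                 (λ ((wa , _) , light) → wa , light) (allFin n))
                     (sparse-neighbours-few t (N? u) (N-sym uw) (λ ua → ua) (t*t≤deg u)))
          heavy
    ... | h , (wh , zh) , ¬light = heavy-neighbour⇒sparse-Far (N-sym zh) (≮⇒≥ ¬light)

    far-degree-bound : ∀ {u w q z} → N u w → N w q → N q z → ∣ far? u ∩? N? z ∣ < t * t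
    far-degree-bound {u} {w} {q} {z} uw wq qz = ≰⇒> λ t*t≤ →
      <⇒≱ (sparse-neighbours-few t (far? u ∩? N? z) qz proj₂ t*t≤)
          (≤-trans many-good (count-mono (N? q ∩? good?) (N? q ∩? sparse? t (far? u ∩? N? z))
                                         (λ (qa , good) → qa , sparse-anti (far? u ∩? N? z) (far? u) proj₁ good)
                                         (allFin n)))
      where
        open ≤-Reasoning
        good? : Decidable (Sparse t (far? u))
        good? = sparse? t (far? u)
        bad⊆ : N q ∩ ∁ (Sparse t (far? u)) ⊆ N q ∩ Sparse t (N? w)
        bad⊆ (qa , ¬good) = qa , ≰⇒> (¬good ∘ heavy-codegree⇒sparse-Far uw)
        few-bad : ∣ N? q ∩? ∁? good? ∣ < t
        few-bad = ≤-<-trans (count-mono (N? q ∩? ∁? good?) (N? q ∩? sparse? t (N? w)) bad⊆ (allFin n))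
                            (sparse-neighbours-few t (N? w) (N-sym wq) (λ wa → wa) (t*t≤deg w))
        many-good : t ≤ ∣ N? q ∩? good? ∣
        many-good = ∩-count-lower (N? q) good? (allFin n) (begin
          t + ∣ N? q ∩? ∁? good? ∣  ≤⟨ +-monoʳ-≤ t (<⇒≤ few-bad) ⟩
          t + t                     ≤⟨ +-mono-≤ (m≤m*m t) (m≤m*m t) ⟩
          t * t + t * t             ≤⟨ δ q ⟩
          ∣ N? q ∣                  ∎)

    close-to-both : ∀ {u a b m c d v} → N u a → N a b → N b m → N m c → N c d → N d v →
                    ∃ λ w → ¬ Far u w × ¬ Far v w
    close-to-both {u} {m = m} {v = v} ua ab bm mc cd dv =
      let (w , _ , ¬far) = ∃-∩∁ (N? m) (far? u ∪? far? v) (allFin n) few-far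
      in w , ¬far ∘ inj₁ , ¬far ∘ inj₂
      where
        open ≤-Reasoning
        few-far : ∣ N? m ∩? (far? u ∪? far? v) ∣ < ∣ N? m ∣
        few-far = begin-strict
          ∣ N? m ∩? (far? u ∪? far? v) ∣
            ≤⟨ count-mono (N? m ∩? (far? u ∪? far? v)) ((far? u ∩? N? m) ∪? (far? v ∩? N? m))
                          (λ { (mw , inj₁ far) → inj₁ (far , mw) ; (mw , inj₂ far) → inj₂ (far , mw) })
                          (allFin n) ⟩
          ∣ (far? u ∩? N? m) ∪? (far? v ∩? N? m) ∣
            ≤⟨ count-∪ (far? u ∩? N? m) (far? v ∩? N? m) (allFin n) ⟩
          ∣ far? u ∩? N? m ∣ + ∣ far? v ∩? N? m ∣
            <⟨ +-mono-< (far-degree-bound ua ab bm) (far-degree-bound (N-sym dv) (N-sym cd) (N-sym mc)) ⟩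
          t * t + t * t
            ≤⟨ δ m ⟩
          ∣ N? m ∣
            ∎

    shortcut : ∀ {u v} → Walk G u v 6 → Walk G u v 4
    shortcut (step ua (step ab (step bm (step mc (step cd (step dv here)))))) =
      let (b , ¬far-u , ¬far-v) = close-to-both (Adj⇒N ua) (Adj⇒N ab) (Adj⇒N bm)
                                                (Adj⇒N mc) (Adj⇒N cd) (Adj⇒N dv)
          (a₁ , ua₁ , a₁b) = ¬Far⇒common-neighbour ¬far-u
          (a₂ , va₂ , a₂b) = ¬Far⇒common-neighbour ¬far-v
      in step (N⇒Adj ua₁) (step (N⇒Adj a₁b) (step (N⇒Adj (N-sym a₂b)) (step (N⇒Adj (N-sym va₂)) here)))

    walk⇒dist≤5 : ∀ {u v l} → Walk G u v l → Dist≤ G u v 5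
    walk⇒dist≤5 here = 0 , z≤n , here
    walk⇒dist≤5 (step uw W) with walk⇒dist≤5 W
    ... | l , l≤5 , W′ with m≤n⇒m<n∨m≡n l≤5
    ...   | inj₁ l<5  = suc l , l<5 , step uw W′
    ...   | inj₂ refl = 4 , n≤1+n 4 , shortcut (step uw W′)

lemma1p12 : Σ (ℕ → ℕ) λ C₅ → (t n : ℕ) (G : Graph n) → Connected G → Bipartite G → MinDegree≥ G (C₅ t) → InducedSFree G t → Diameter≤ G 5
lemma1p12 = (λ t → t * t + t * t) , λ t n G connected bipartite δ S-free u v →
  Diameter.walk⇒dist≤5 {G = G} (bipartite⇒triangleFree {G = G} bipartite) {t = t} S-free δ
                       (proj₂ (connected u v))
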